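{- Let $G=(N,T,S,P)$ be an MCFG and let $G'=(N,T,P',S)$ be the context-free cowordism grammar in which each nonterminal $C\in N$ is assigned its carrier $[C]$ and $P'=\{[p]\mid p\in P\}$, where $[p]$ is the cowordism representing the production $p$. Then for any predicate symbol $C\in N$ of arity $k$ and words $s_1,\ldots,s_k\in T^*$, it holds that $\vdash_G C(s_1,\ldots,s_k)$ iff $\vdash_{G'}[C(s_1,\ldots,s_k)]:C$. In particular, $L(G)=L(G')$.
   Context: An MCFG $G=(N,T,S,P)$ has nonterminal predicate symbols, terminals $T$, unary start symbol $S$, and productions $B_1(x^1_1,\ldots,x^1_{k_1}),\ldots,B_n(x^n_1,\ldots,x^n_{k_n})\vdash A(s_1,\ldots,s_k)$ (non-erasing, each variable used exactly once); $\vdash_G$ denotes derivability of predicate formulas by substituting derivable tuples into productions, and $L(G)=\{w\mid \vdash_G S(w)\}$. The carrier $[C]$ of a $k$-ary symbol is the boundary of cardinality $2k$ with left endpoints $\{1,3,\ldots,2k-1\}$, and $[C(s_1,\ldots,s_k)]:\mathbf{1}\to[C]$ is the cowordism with edges $(2i-1,s_i,2i)$. For a production $p$, $[p]:[B_1]\otimes\ldots\otimes[B_n]\to[A]$ is a cowordism satisfying $[p]\circ([B_1(x^1_1,\ldots)]\otimes\ldots\otimes[B_n(x^n_1,\ldots)])=[A(s_1,\ldots,s_k)]$. A context-free cowordism grammar $G'=(N,T,P',S)$ has types with carrier boundaries, productions $\sigma:A_1\otimes\ldots\otimes A_n\to A$ given by cowordisms $[A_1]\otimes\ldots\otimes[A_n]\to[A]$,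 and the generated cowordisms are defined inductively: if $\sigma:\mathbf{1}\to A$ is a production then $\vdash_{G'}\sigma:A$; if $\sigma:A_1\otimes\ldots\otimes A_n\to A$ is a production and $\vdash_{G'}\tau_i:A_i$, then $\vdash_{G'}\sigma\circ(\tau_1\otimes\ldots\otimes\tau_n):A$. $L(G')$ is the set of words labelling the single edge of regular cowordisms of type $S$ generated by $G'$. -}

module Defs where

open import Data.Nat using (ℕ; zero; suc)
open import Data.Nat.Base using (_≡ᵇ_; _<ᵇ_; _≤ᵇ_)
open import Data.Bool using (Bool; true; false; _∧_; _∨_; if_then_else_)
open import Data.Fin using (Fin; toℕ)
open import Data.Vec using (Vec; lookup; toList; _∷_; [])
open import Data.List using (List; []; _∷_; _++_; concat; concatMap; map; allFin; length)
open import Data.List.Membership.Propositional using (_∈_)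
open import Data.List.Relation.Unary.Unique.Propositional using (Unique)
open import Data.List.Relation.Binary.Permutation.Propositional using (_↭_)
open import Data.List.Relation.Binary.Pointwise using (Pointwise)
open import Data.Maybe using (Maybe; just; nothing; fromMaybe)
open import Data.Sum using (_⊎_; inj₁; inj₂)
open import Data.Product using (Σ; _×_; _,_; proj₁; proj₂; ∃)
open import Function.Bundles using (_↔_; _⇔_)
open import Relation.Binary.PropositionalEquality using (_≡_; subst; sym)

module Base (N T : Set) (ar : N → ℕ) where

  -- the empty family of types (domain of cowordisms 1 → [A])
  ∅ : Fin 0 → N
  ∅ ()

  -- The pairs of points of the tensor of carriers [B₁] ⊗ … ⊗ [Bₙ]:
  -- pair (i , j) consists of the points 2j-1 (left) and 2j (right) of the
  -- i-th block [Bᵢ].  (Also: the variables x^i_j of a production.)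
  DPt : ∀ {n} → (Fin n → N) → Set
  DPt {n} Bs = Σ (Fin n) λ i → Fin (ar (Bs i))

  allDPt : ∀ {n} (Bs : Fin n → N) → List (DPt Bs)
  allDPt {n} Bs = concatMap (λ i → map (λ j → (i , j)) (allFin (ar (Bs i)))) (allFin n)

  eqᵇ : ∀ {n} {Bs : Fin n → N} → DPt Bs → DPt Bs → Bool
  eqᵇ (i , j) (i' , j') = (toℕ i ≡ᵇ toℕ i') ∧ (toℕ j ≡ᵇ toℕ j')

  allᵇ : ∀ {X : Set} → (X → Bool) → List X → Bool
  allᵇ f [] = true
  allᵇ f (x ∷ xs) = f x ∧ allᵇ f xs

  leqᵇ : ∀ {n} {Bs : Fin n → N} → DPt Bs → DPt Bs → Bool
  leqᵇ (i , j) (i' , j') = (toℕ i <ᵇ toℕ i') ∨ ((toℕ i ≡ᵇ toℕ i') ∧ (toℕ j ≤ᵇ toℕ j'))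

  -- The sources ("outgoing" points) are the right
  -- points of the domain (inj₁ d = point 2j of block i, d = (i , j)) and the
  -- left points of the codomain (inj₂ j = point 2j-1 of [A]); the targets are
  -- the left points of the domain (inj₁ d = point 2j-1 of block i) and the
  -- right points of the codomain (inj₂ j = point 2j of [A]).
  -- A cowordism is the set of edges (s , label s , edge s), one per source
  -- (edge is a bijection for genuine cowordisms), together with the
  -- multiset of closed loops, each labelled by a cyclic word.
  Pt : ∀ {n} → (Fin n → N) → N → Set
  Pt Bs A = DPt Bs ⊎ Fin (ar A)

  record Cowordism {n} (Bs : Fin n → N) (A : N) : Set where
    field
      edge  : Pt Bs A → Pt Bs A
      label : Pt Bs A → List T
      loops : List (List T)
  open Cowordism public

  Rot : List T → List T → Set
  Rot u v = Σ (List T) λ a → Σ (List T) λ b → (u ≡ a ++ b) × (v ≡ b ++ a)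

  _≈_ : ∀ {n} {Bs : Fin n → N} {A} → Cowordism Bs A → Cowordism Bs A → Set
  σ ≈ ρ = (∀ s → edge σ s ≡ edge ρ s) × (∀ s → label σ s ≡ label ρ s)
        × Σ (List (List T)) (λ zs → (loops σ ↭ zs) × Pointwise Rot zs (loops ρ))

  Regular : ∀ {n} {Bs : Fin n → N} {A} → Cowordism Bs A → Set
  Regular σ = loops σ ≡ []

  ⟦_⟨_⟩⟧ : (C : N) → Vec (List T) (ar C) → Cowordism ∅ C
  edge  ⟦ C ⟨ s ⟩⟧ (inj₁ (() , _))
  edge  ⟦ C ⟨ s ⟩⟧ (inj₂ j) = inj₂ j
  label ⟦ C ⟨ s ⟩⟧ (inj₁ (() , _))
  label ⟦ C ⟨ s ⟩⟧ (inj₂ j) = lookup s j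
  loops ⟦ C ⟨ s ⟩⟧ = []

  -- Composition σ ∘ (τ₁ ⊗ … ⊗ τₙ) of σ : [B₁]⊗…⊗[Bₙ] → [A] with
  -- τᵢ : 1 → [Bᵢ]: glue along the middle boundary, concatenating words.
  module Comp {n} {Bs : Fin n → N} {A : N}
              (σ : Cowordism Bs A) (τ : (i : Fin n) → Cowordism ∅ (Bs i)) where

    -- at a domain left point (i , j) continue along the edge of τᵢ starting
    -- at its left point j; it ends at a right point j' of [Bᵢ], which is the
    -- domain right point (i , j') of σ.
    τstep : DPt Bs → DPt Bs × List T
    τstep (i , j) with edge (τ i) (inj₂ j)
    ... | inj₁ (() , _)
    ... | inj₂ j' = (i , j') , label (τ i) (inj₂ j)

    fuel : ℕ
    fuel = suc (length (allDPt Bs))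

    pathFrom : ℕ → Pt Bs A → Maybe (Fin (ar A) × List T)
    pathFrom f s with edge σ s
    ... | inj₂ j = just (j , label σ s)
    pathFrom zero s    | inj₁ d = nothing
    pathFrom (suc f) s | inj₁ d with τstep d | pathFrom f (inj₁ (proj₁ (τstep d)))
    ... | (e , v) | nothing = nothing
    ... | (e , v) | just (j , w) = just (j , (label σ s ++ v ++ w))

    -- the closed loop through the domain right point `start`, starting at
    -- `cur`; returns its word and the list of domain right points visited
    loopFrom : ℕ → DPt Bs → DPt Bs → Maybe (List T × List (DPt Bs))
    loopFrom zero start cur = nothing
    loopFrom (suc f) start cur with edge σ (inj₁ cur)
    ... | inj₂ _ = nothing
    ... | inj₁ d with τstep d
    ...   | (e , v) with eqᵇ e start
    ...     | true = just (label σ (inj₁ cur) ++ v , [])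
    ...     | false with loopFrom f start e
    ...       | nothing = nothing
    ...       | just (w , vs) = just (label σ (inj₁ cur) ++ v ++ w , e ∷ vs)

    -- each new loop is recorded once, read from its lexicographically least point
    newLoop : DPt Bs → List (List T)
    newLoop d with loopFrom fuel d d
    ... | nothing = []
    ... | just (w , vs) = if allᵇ (leqᵇ d) vs then w ∷ [] else []

    result : Cowordism ∅ A
    edge result (inj₁ (() , _))
    edge result (inj₂ j) = inj₂ (proj₁ (fromMaybe (j , []) (pathFrom fuel (inj₂ j))))
    label result (inj₁ (() , _))
    label result (inj₂ j) = proj₂ (fromMaybe (j , []) (pathFrom fuel (inj₂ j)))
    loops result = loops σ ++ concatMap (λ i → loops (τ i)) (allFin n)
                   ++ concatMap newLoop (allDPt Bs)

  _∘⊗_ : ∀ {n} {Bs : Fin n → N} {A : N} → Cowordism Bs A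
       → ((i : Fin n) → Cowordism ∅ (Bs i)) → Cowordism ∅ A
  σ ∘⊗ τ = Comp.result σ τ

  -- MCFG productions B₁(x¹…) , … , Bₙ(xⁿ…) ⊢ A(s₁,…,s_k);
  -- the variable x^i_j is represented by (i , j) : DPt body.
  varsOf : ∀ {V : Set} → List (T ⊎ V) → List V
  varsOf [] = []
  varsOf (inj₁ _ ∷ xs) = varsOf xs
  varsOf (inj₂ v ∷ xs) = v ∷ varsOf xs

  record Production : Set where
    field
      n    : ℕ
      body : Fin n → N
      head : N
      rhs  : Vec (List (T ⊎ DPt body)) (ar head)
      allUsed : ∀ v → v ∈ concatMap varsOf (toList rhs)
      linear  : Unique (concatMap varsOf (toList rhs))
  open Production public

  instantiate : ∀ {n} {Bs : Fin n → N} → ((i : Fin n) → Vec (List T) (ar (Bs i)))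
              → List (T ⊎ DPt Bs) → List T
  instantiate args [] = []
  instantiate args (inj₁ a ∷ xs) = a ∷ instantiate args xs
  instantiate args (inj₂ (i , j) ∷ xs) = lookup (args i) j ++ instantiate args xs

  -- The cowordism [p] : [B₁] ⊗ … ⊗ [Bₙ] → [A] of a production p:
  -- writing sⱼ = w₀ x_{a₁} w₁ … x_{aₘ} wₘ, the edges are
  -- (2j-1, w₀, left of x_{a₁}), (right of x_{a₁}, w₁, left of x_{a₂}), …,
  -- (right of x_{aₘ}, wₘ, 2j).  It is the cowordism satisfying
  -- [p] ∘ ([B₁(x¹…)] ⊗ …) = [A(s₁,…,s_k)].
  module ProdCow (p : Production) where
    Tgt = Pt (body p) (head p)

    next : List (T ⊎ DPt (body p)) → Fin (ar (head p)) → Tgt × List T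
    next [] j = inj₂ j , []
    next (inj₁ a ∷ xs) j with next xs j
    ... | (t , w) = t , (a ∷ w)
    next (inj₂ v ∷ xs) j = inj₁ v , []

    after : DPt (body p) → List (T ⊎ DPt (body p)) → Maybe (List (T ⊎ DPt (body p)))
    after v [] = nothing
    after v (inj₁ a ∷ xs) = after v xs
    after v (inj₂ u ∷ xs) = if eqᵇ u v then just xs else after v xs

    search : DPt (body p) → List (Fin (ar (head p))) → Tgt × List T
    search v [] = inj₁ v , []
    search v (j ∷ js) with after v (lookup (rhs p) j)
    ... | just rest = next rest j
    ... | nothing = search v js

    out : Tgt → Tgt × List T
    out (inj₂ j) = next (lookup (rhs p) j) j
    out (inj₁ v) = search v (allFin (ar (head p)))

    cow : Cowordism (body p) (head p)
    edge cow s = proj₁ (out s)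
    label cow s = proj₂ (out s)
    loops cow = []

  ⟦_⟧ₚ : (p : Production) → Cowordism (body p) (head p)
  ⟦ p ⟧ₚ = ProdCow.cow p

record MCFG : Set₁ where
  field
    N       : Set
    T       : Set
    N-finite : Σ ℕ λ m → N ↔ Fin m
    T-finite : Σ ℕ λ m → T ↔ Fin m
    ar      : N → ℕ
    S       : N
    S-unary : ar S ≡ 1
    P       : List (Base.Production N T ar)

module _ (G : MCFG) where
  open MCFG G
  open Base N T ar

  data ⊢G : (C : N) → Vec (List T) (ar C) → Set where
    rule : (p : Production) → p ∈ P
         → (args : (i : Fin (n p)) → Vec (List T) (ar (body p i)))
         → ((i : Fin (n p)) → ⊢G (body p i) (args i))
         → ⊢G (head p) (Data.Vec.map (instantiate args) (rhs p))

  -- the context-free cowordism grammar G' with P' = { [p] | p ∈ P }: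
  -- ⊢_{G'} σ : C.  (The clause for productions σ : 1 → A is the n = 0
  -- instance: σ ∘ (empty tensor) = σ.)
  data ⊢G' : (C : N) → Cowordism ∅ C → Set where
    gen : (p : Production) → p ∈ P
        → (τ : (i : Fin (n p)) → Cowordism ∅ (body p i))
        → ((i : Fin (n p)) → ⊢G' (body p i) (τ i))
        → ⊢G' (head p) (⟦ p ⟧ₚ ∘⊗ τ)

  -- "⊢_{G'} [C(s)] : C" (up to equality of cowordisms)
  Derivable' : (C : N) → Cowordism ∅ C → Set
  Derivable' C σ = Σ (Cowordism ∅ C) λ ρ → ⊢G' C ρ × (ρ ≈ σ)

  sPt : Fin (ar S)
  sPt = subst Fin (sym S-unary) Fin.zero
    where import Data.Fin as Fin

  LG : List T → Set
  LG w = ⊢G S (subst (Vec (List T)) (sym S-unary) (w ∷ []))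

  LG' : List T → Set
  LG' w = Σ (Cowordism ∅ S) λ σ → ⊢G' S σ × Regular σ × (label σ (inj₂ sPt) ≡ w)

-- Let p be a production B₁(x¹…) , … , Bₙ(xⁿ…) ⊢ A(s₁,…,s_k) and let tᵢ be
-- tuples for the Bᵢ.  Composing [p] with the straight cowordisms [Bᵢ(tᵢ)]
-- makes the path starting at the left point 2j-1 of [A] read sⱼ from left
-- to right: a terminal run is read off an edge of [p], and a variable x^i_l
-- is crossed along the l-th edge of [Bᵢ(tᵢ)], contributing its word tᵢₗ.
-- Since every variable occurs exactly once, such a path visits each variable
-- at most once (so it ends in [A] within the available fuel), and the path
-- leaving any variable never returns to it, so no closed loop appears.
-- Hence [p] ∘ ([B₁(t₁)] ⊗ … ⊗ [Bₙ(tₙ)]) = [A(s[t])], and derivations of G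
-- and of G' correspond rule by rule.
module Submission where

open import Defs
open import Data.Bool using (true; false)
open import Data.Bool.Properties using (T-∧; T-≡)
open import Data.Nat using (ℕ; zero; suc; _≤_; z≤n; s≤s)
open import Data.Nat.Properties using (≡ᵇ⇒≡; ≡⇒≡ᵇ; ≤-trans; n≤1+n; +-suc)
open import Data.Fin using (Fin; toℕ) renaming (zero to fzero; suc to fsuc)
open import Data.Fin.Properties using (toℕ-injective; _≟_)
open import Data.List using (List; []; _∷_; _++_; [_]; length; map; concatMap; allFin)
open import Data.List.Properties using (++-assoc; ++-identityʳ; length-++)
open import Data.List.Membership.Propositional using (_∈_; _∉_)
open import Data.List.Membership.Propositional.Properties
  using (∈-∃++; ∈-++⁻; ∈-++⁺ˡ; ∈-++⁺ʳ; ∈-allFin; ∈-map⁺; ∈-concatMap⁺)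
open import Data.List.Relation.Unary.Any using (here; there)
import Data.List.Relation.Unary.Any as Any
import Data.List.Relation.Unary.All as All
open import Data.List.Relation.Unary.All.Properties using (++⁻ˡ; ++⁻ʳ)
open import Data.List.Relation.Unary.AllPairs using ([]; _∷_)
open import Data.List.Relation.Unary.Unique.Propositional using (Unique)
open import Data.List.Relation.Unary.Unique.Propositional.Properties using (Unique[x∷xs]⇒x∉xs)
open import Data.List.Relation.Binary.Disjoint.Propositional using (Disjoint)
open import Data.List.Relation.Binary.Subset.Propositional using (_⊆_)
open import Data.List.Relation.Binary.Permutation.Propositional using (_↭_; ↭-refl)
import Data.List.Relation.Binary.Pointwise.Properties as Pointwise
open import Data.Vec using (Vec; lookup; toList) renaming ([] to []ᵥ; _∷_ to _∷ᵥ_; map to mapᵥ)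
open import Data.Vec.Properties using (lookup-map)
open import Data.Vec.Relation.Binary.Pointwise.Extensional using (ext; Pointwise-≡⇒≡)
open import Data.Maybe using (just; nothing)
open import Data.Sum using (_⊎_; inj₁; inj₂)
open import Data.Product using (∃; ∃₂; _×_; _,_; proj₁; proj₂)
open import Data.Empty using (⊥-elim)
open import Function.Bundles using (_⇔_; mk⇔; Equivalence)
open import Relation.Nullary using (yes; no)
open import Relation.Binary.PropositionalEquality
  using (_≡_; _≢_; refl; sym; trans; cong; cong₂; subst; module ≡-Reasoning)

module _ {A : Set} where

  Unique-++⁻ˡ : ∀ xs {ys : List A} → Unique (xs ++ ys) → Unique xs
  Unique-++⁻ˡ []       _        = []
  Unique-++⁻ˡ (x ∷ xs) (x∉ ∷ u) = ++⁻ˡ xs x∉ ∷ Unique-++⁻ˡ xs u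

  Unique-++⁻ʳ : ∀ xs {ys : List A} → Unique (xs ++ ys) → Unique ys
  Unique-++⁻ʳ []       u       = u
  Unique-++⁻ʳ (x ∷ xs) (_ ∷ u) = Unique-++⁻ʳ xs u

  Unique-++⇒Disjoint : ∀ xs {ys : List A} → Unique (xs ++ ys) → Disjoint xs ys
  Unique-++⇒Disjoint (x ∷ xs) (x∉ ∷ u) (here refl , v∈ys) = All.lookup (++⁻ʳ xs x∉) v∈ys refl
  Unique-++⇒Disjoint (x ∷ xs) (_  ∷ u) (there v∈xs , v∈ys) = Unique-++⇒Disjoint xs u (v∈xs , v∈ys)

  Unique-++-∷⇒∉ : ∀ xs {v : A} {ys} → Unique (xs ++ v ∷ ys) → v ∉ xs × v ∉ ys
  Unique-++-∷⇒∉ xs u =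
    (λ v∈xs → Unique-++⇒Disjoint xs u (v∈xs , here refl)) , Unique[x∷xs]⇒x∉xs (Unique-++⁻ʳ xs u)

  Unique-⊆⇒length-≤ : ∀ {xs ys : List A} → Unique xs → xs ⊆ ys → length xs ≤ length ys
  Unique-⊆⇒length-≤ {[]}     _          _  = z≤n
  Unique-⊆⇒length-≤ {x ∷ xs} (x∉ ∷ u) xs⊆ys with ∈-∃++ (xs⊆ys (here refl))
  ... | as , bs , refl =
    subst (suc (length xs) ≤_) (sym length-split) (s≤s (Unique-⊆⇒length-≤ u xs⊆as++bs))
    where
    xs⊆as++bs : xs ⊆ as ++ bs
    xs⊆as++bs {y} y∈xs with ∈-++⁻ as (xs⊆ys (there y∈xs))
    ... | inj₁ y∈as          = ∈-++⁺ˡ y∈as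
    ... | inj₂ (here refl)   = ⊥-elim (All.lookup x∉ y∈xs refl)
    ... | inj₂ (there y∈bs)  = ∈-++⁺ʳ as y∈bs
    length-split : length (as ++ x ∷ bs) ≡ suc (length (as ++ bs))
    length-split = trans (length-++ as) (trans (+-suc (length as) (length bs)) (cong suc (sym (length-++ as))))

  concatMap-[] : ∀ {B : Set} (f : B → List A) xs → (∀ x → f x ≡ []) → concatMap f xs ≡ []
  concatMap-[] f []       f≡[] = refl
  concatMap-[] f (x ∷ xs) f≡[] rewrite f≡[] x = concatMap-[] f xs f≡[]

  ++-∷-reassoc : ∀ (xs ys : List A) y zs → xs ++ ys ++ y ∷ zs ≡ (xs ++ ys ++ [ y ]) ++ zs
  ++-∷-reassoc xs ys y zs = begin
    xs ++ (ys ++ y ∷ zs)        ≡⟨ cong (xs ++_) (sym (++-assoc ys [ y ] zs)) ⟩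
    xs ++ ((ys ++ [ y ]) ++ zs) ≡⟨ sym (++-assoc xs (ys ++ [ y ]) zs) ⟩
    (xs ++ ys ++ [ y ]) ++ zs   ∎
    where open ≡-Reasoning

module _ {A B : Set} (f : B → List A) where

  ∈-lookup⇒∈-concatMap : ∀ {m v} (xs : Vec B m) j → v ∈ f (lookup xs j) → v ∈ concatMap f (toList xs)
  ∈-lookup⇒∈-concatMap (x ∷ᵥ xs) fzero    v∈ = ∈-++⁺ˡ v∈
  ∈-lookup⇒∈-concatMap (x ∷ᵥ xs) (fsuc j) v∈ = ∈-++⁺ʳ (f x) (∈-lookup⇒∈-concatMap xs j v∈)

  ∈-concatMap⇒∈-lookup : ∀ {m v} (xs : Vec B m) → v ∈ concatMap f (toList xs)
                       → ∃ λ j → v ∈ f (lookup xs j)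
  ∈-concatMap⇒∈-lookup (x ∷ᵥ xs) v∈ with ∈-++⁻ (f x) v∈
  ... | inj₁ v∈fx = fzero , v∈fx
  ... | inj₂ v∈xs with ∈-concatMap⇒∈-lookup xs v∈xs
  ...   | j , v∈fxⱼ = fsuc j , v∈fxⱼ

  Unique-concatMap⇒Unique-lookup : ∀ {m} (xs : Vec B m) j → Unique (concatMap f (toList xs))
                                 → Unique (f (lookup xs j))
  Unique-concatMap⇒Unique-lookup (x ∷ᵥ xs) fzero    u = Unique-++⁻ˡ (f x) u
  Unique-concatMap⇒Unique-lookup (x ∷ᵥ xs) (fsuc j) u = Unique-concatMap⇒Unique-lookup xs j (Unique-++⁻ʳ (f x) u)

  Unique-concatMap⇒Disjoint-lookup : ∀ {m} (xs : Vec B m) {k j} → Unique (concatMap f (toList xs)) → k ≢ j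
                                   → Disjoint (f (lookup xs k)) (f (lookup xs j))
  Unique-concatMap⇒Disjoint-lookup (x ∷ᵥ xs) {fzero}  {fzero}  u k≢j _ = k≢j refl
  Unique-concatMap⇒Disjoint-lookup (x ∷ᵥ xs) {fzero}  {fsuc j} u k≢j (v∈x , v∈xⱼ) =
    Unique-++⇒Disjoint (f x) u (v∈x , ∈-lookup⇒∈-concatMap xs j v∈xⱼ)
  Unique-concatMap⇒Disjoint-lookup (x ∷ᵥ xs) {fsuc k} {fzero}  u k≢j (v∈xₖ , v∈x) =
    Unique-++⇒Disjoint (f x) u (v∈x , ∈-lookup⇒∈-concatMap xs k v∈xₖ)
  Unique-concatMap⇒Disjoint-lookup (x ∷ᵥ xs) {fsuc k} {fsuc j} u k≢j =
    Unique-concatMap⇒Disjoint-lookup xs (Unique-++⁻ʳ (f x) u) (λ k≡j → k≢j (cong fsuc k≡j))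

lookup-singleton-subst : ∀ {X : Set} {m} (e : m ≡ 1) (w : X)
                       → lookup (subst (Vec X) (sym e) (w ∷ᵥ []ᵥ)) (subst Fin (sym e) fzero) ≡ w
lookup-singleton-subst refl w = refl

≡-singleton-subst : ∀ {X : Set} {m} (e : m ≡ 1) (w : X) (t : Vec X m)
                  → lookup t (subst Fin (sym e) fzero) ≡ w → t ≡ subst (Vec X) (sym e) (w ∷ᵥ []ᵥ)
≡-singleton-subst refl w (x ∷ᵥ []ᵥ) refl = refl

module Cowordisms (N T : Set) (ar : N → ℕ) where
  open Base N T ar

  record _≐_ {n} {Bs : Fin n → N} {A} (σ ρ : Cowordism Bs A) : Set where
    field
      edge-≡  : ∀ x → edge σ x ≡ edge ρ x
      label-≡ : ∀ x → label σ x ≡ label ρ x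
      loops-≡ : loops σ ≡ loops ρ
  open _≐_ public
  infix 4 _≐_

  Rot-refl : ∀ u → Rot u u
  Rot-refl u = u , [] , sym (++-identityʳ u) , refl

  ≐⇒≈ : ∀ {n} {Bs : Fin n → N} {A} {σ ρ : Cowordism Bs A} → σ ≐ ρ → σ ≈ ρ
  ≐⇒≈ {σ = σ} {ρ} σ≐ρ =
    edge-≡ σ≐ρ , label-≡ σ≐ρ ,
    loops ρ , subst (loops σ ↭_) (loops-≡ σ≐ρ) ↭-refl , Pointwise.refl (Rot-refl _)

  eqᵇ⇒≡ : ∀ {n} {Bs : Fin n → N} {u v : DPt Bs} → eqᵇ u v ≡ true → u ≡ v
  eqᵇ⇒≡ {u = i , j} {i′ , j′} e with Equivalence.to T-∧ (Equivalence.from T-≡ e)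
  ... | i≡ᵇi′ , j≡ᵇj′ with toℕ-injective (≡ᵇ⇒≡ (toℕ i) (toℕ i′) i≡ᵇi′)
  ... | refl with toℕ-injective (≡ᵇ⇒≡ (toℕ j) (toℕ j′) j≡ᵇj′)
  ... | refl = refl

  eqᵇ-refl : ∀ {n} {Bs : Fin n → N} (u : DPt Bs) → eqᵇ u u ≡ true
  eqᵇ-refl (i , j) =
    Equivalence.to T-≡ (Equivalence.from T-∧ (≡⇒≡ᵇ (toℕ i) (toℕ i) refl , ≡⇒≡ᵇ (toℕ j) (toℕ j) refl))

  eqᵇ-≢ : ∀ {n} {Bs : Fin n → N} {u v : DPt Bs} → u ≢ v → eqᵇ u v ≡ false
  eqᵇ-≢ {u = u} {v} u≢v with eqᵇ u v in e
  ... | true  = ⊥-elim (u≢v (eqᵇ⇒≡ e))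
  ... | false = refl

  ∈-allDPt : ∀ {n} (Bs : Fin n → N) (d : DPt Bs) → d ∈ allDPt Bs
  ∈-allDPt Bs (i , j) =
    ∈-concatMap⁺ (λ i → map (i ,_) (allFin (ar (Bs i))))
                 (Any.map (λ { refl → ∈-map⁺ (i ,_) (∈-allFin j) }) (∈-allFin i))

  module CompositionSteps {n} {Bs : Fin n → N} {A : N}
                          (σ : Cowordism Bs A) (τ : (i : Fin n) → Cowordism ∅ (Bs i)) where
    open Comp σ τ

    τstep-straight : ∀ {i j j′} → edge (τ i) (inj₂ j) ≡ inj₂ j′
                   → τstep (i , j) ≡ ((i , j′) , label (τ i) (inj₂ j))
    τstep-straight {i} {j} e with edge (τ i) (inj₂ j) | e
    ... | inj₂ _ | refl = refl

    pathFrom-exit : ∀ f s {j} → edge σ s ≡ inj₂ j → pathFrom f s ≡ just (j , label σ s)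
    pathFrom-exit f s e with edge σ s | e
    ... | inj₂ _ | refl = refl

    pathFrom-through : ∀ f s {d e w j u} → edge σ s ≡ inj₁ d → τstep d ≡ (e , w)
                     → pathFrom f (inj₁ e) ≡ just (j , u)
                     → pathFrom (suc f) s ≡ just (j , label σ s ++ w ++ u)
    pathFrom-through f s {d} {e} e₁ e₂ e₃ with edge σ s | e₁
    ... | inj₁ _ | refl with τstep d | e₂
    ... | _ | refl with pathFrom f (inj₁ e) | e₃
    ... | _ | refl = refl

    loopFrom-exit : ∀ f start cur {j} → edge σ (inj₁ cur) ≡ inj₂ j → loopFrom f start cur ≡ nothing
    loopFrom-exit zero    start cur e = refl
    loopFrom-exit (suc f) start cur e with edge σ (inj₁ cur) | e
    ... | inj₂ _ | refl = refl

    loopFrom-through : ∀ f start cur {d e w} → edge σ (inj₁ cur) ≡ inj₁ d → τstep d ≡ (e , w)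
                     → e ≢ start → loopFrom f start e ≡ nothing → loopFrom (suc f) start cur ≡ nothing
    loopFrom-through f start cur {d} {e} e₁ e₂ e≢start e₃ with edge σ (inj₁ cur) | e₁
    ... | inj₁ _ | refl with τstep d | e₂
    ... | _ | refl rewrite eqᵇ-≢ e≢start with loopFrom f start e | e₃
    ... | _ | refl = refl

    newLoop-none : ∀ d → loopFrom fuel d d ≡ nothing → newLoop d ≡ []
    newLoop-none d e with loopFrom fuel d d | e
    ... | _ | refl = refl

  module _ {V : Set} where

    varsOf-++ : ∀ (xs ys : List (T ⊎ V)) → varsOf (xs ++ ys) ≡ varsOf xs ++ varsOf ys
    varsOf-++ []            ys = refl
    varsOf-++ (inj₁ a ∷ xs) ys = varsOf-++ xs ys
    varsOf-++ (inj₂ v ∷ xs) ys = cong (v ∷_) (varsOf-++ xs ys)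

    varsOf-terminals++ : ∀ (as : List T) (xs : List (T ⊎ V)) → varsOf (map inj₁ as ++ xs) ≡ varsOf xs
    varsOf-terminals++ []       xs = refl
    varsOf-terminals++ (a ∷ as) xs = varsOf-terminals++ as xs

    ∈-varsOf⇒split : ∀ {v} (xs : List (T ⊎ V)) → v ∈ varsOf xs
                   → ∃₂ λ ys rest → xs ≡ ys ++ inj₂ v ∷ rest
    ∈-varsOf⇒split (inj₁ a ∷ xs) v∈ with ∈-varsOf⇒split xs v∈
    ... | ys , rest , refl = inj₁ a ∷ ys , rest , refl
    ∈-varsOf⇒split (inj₂ u ∷ xs) (here refl) = [] , xs , refl
    ∈-varsOf⇒split (inj₂ u ∷ xs) (there v∈) with ∈-varsOf⇒split xs v∈
    ... | ys , rest , refl = inj₂ u ∷ ys , rest , refl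

    ∈-varsOf-split : ∀ (ys : List (T ⊎ V)) v rest → v ∈ varsOf (ys ++ inj₂ v ∷ rest)
    ∈-varsOf-split ys v rest =
      subst (v ∈_) (sym (varsOf-++ ys (inj₂ v ∷ rest))) (∈-++⁺ʳ (varsOf ys) (here refl))

    data FirstVar : List (T ⊎ V) → Set where
      noVar    : (as : List T) → FirstVar (map inj₁ as)
      firstVar : (as : List T) (v : V) (rest : List (T ⊎ V)) → FirstVar (map inj₁ as ++ inj₂ v ∷ rest)

    firstVar? : ∀ xs → FirstVar xs
    firstVar? []            = noVar []
    firstVar? (inj₂ v ∷ xs) = firstVar [] v xs
    firstVar? (inj₁ a ∷ xs) with firstVar? xs
    ... | noVar as           = noVar (a ∷ as)
    ... | firstVar as v rest = firstVar (a ∷ as) v rest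

  module _ {n} {Bs : Fin n → N} (args : (i : Fin n) → Vec (List T) (ar (Bs i))) where

    instantiate-terminals : ∀ as → instantiate args (map inj₁ as) ≡ as
    instantiate-terminals []       = refl
    instantiate-terminals (a ∷ as) = cong (a ∷_) (instantiate-terminals as)

    instantiate-terminals++ : ∀ as xs → instantiate args (map inj₁ as ++ xs) ≡ as ++ instantiate args xs
    instantiate-terminals++ []       xs = refl
    instantiate-terminals++ (a ∷ as) xs = cong (a ∷_) (instantiate-terminals++ as xs)

  module ProductionSteps (p : Production) where
    open ProdCow p

    next-noVar : ∀ as j → next (map inj₁ as) j ≡ (inj₂ j , as)
    next-noVar []       j = refl
    next-noVar (a ∷ as) j rewrite next-noVar as j = refl

    next-firstVar : ∀ as v rest j → next (map inj₁ as ++ inj₂ v ∷ rest) j ≡ (inj₁ v , as)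
    next-firstVar []       v rest j = refl
    next-firstVar (a ∷ as) v rest j rewrite next-firstVar as v rest j = refl

    after-∉ : ∀ {v} xs → v ∉ varsOf xs → after v xs ≡ nothing
    after-∉ []            v∉ = refl
    after-∉ (inj₁ a ∷ xs) v∉ = after-∉ xs v∉
    after-∉ (inj₂ u ∷ xs) v∉
      rewrite eqᵇ-≢ (λ u≡v → v∉ (here (sym u≡v))) = after-∉ xs (λ v∈ → v∉ (there v∈))

    after-split : ∀ {v} ys rest → v ∉ varsOf ys → after v (ys ++ inj₂ v ∷ rest) ≡ just rest
    after-split {v} []    rest v∉ rewrite eqᵇ-refl v = refl
    after-split (inj₁ a ∷ ys) rest v∉ = after-split ys rest v∉
    after-split (inj₂ u ∷ ys) rest v∉
      rewrite eqᵇ-≢ (λ u≡v → v∉ (here (sym u≡v))) = after-split ys rest (λ v∈ → v∉ (there v∈))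

    occurrence : ∀ v → ∃ λ j → ∃₂ λ ys rest → lookup (rhs p) j ≡ ys ++ inj₂ v ∷ rest
    occurrence v with ∈-concatMap⇒∈-lookup varsOf (rhs p) (allUsed p v)
    ... | j , v∈ = j , ∈-varsOf⇒split _ v∈

    occurrence-linear : ∀ {j ys v rest} → lookup (rhs p) j ≡ ys ++ inj₂ v ∷ rest
                      → v ∉ varsOf ys × v ∉ varsOf rest
    occurrence-linear {j} {ys} e =
      Unique-++-∷⇒∉ (varsOf ys) (subst Unique (varsOf-++ ys _)
        (subst (λ xs → Unique (varsOf xs)) e (Unique-concatMap⇒Unique-lookup varsOf (rhs p) j (linear p))))

    varsOf-rhs-bounded : ∀ j → length (varsOf (lookup (rhs p) j)) ≤ length (allDPt (body p))
    varsOf-rhs-bounded j =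
      Unique-⊆⇒length-≤ (Unique-concatMap⇒Unique-lookup varsOf (rhs p) j (linear p))
                        (λ {d} _ → ∈-allDPt (body p) d)

    search-unique : ∀ {v j rest} js → j ∈ js → after v (lookup (rhs p) j) ≡ just rest
                  → (∀ k → k ≢ j → after v (lookup (rhs p) k) ≡ nothing) → search v js ≡ next rest j
    search-unique {j = j} (k ∷ js) j∈ hit miss with k ≟ j
    ... | yes refl rewrite hit = refl
    ... | no k≢j rewrite miss k k≢j with j∈
    ...   | here j≡k   = ⊥-elim (k≢j (sym j≡k))
    ...   | there j∈js = search-unique js j∈js hit miss

    out-var : ∀ {j ys v rest} → lookup (rhs p) j ≡ ys ++ inj₂ v ∷ rest → out (inj₁ v) ≡ next rest j
    out-var {j} {ys} {v} {rest} e = search-unique (allFin _) (∈-allFin j) hit miss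
      where
      hit : after v (lookup (rhs p) j) ≡ just rest
      hit = trans (cong (after v) e) (after-split ys rest (proj₁ (occurrence-linear e)))
      v∈ⱼ : v ∈ varsOf (lookup (rhs p) j)
      v∈ⱼ = subst (λ xs → v ∈ varsOf xs) (sym e) (∈-varsOf-split ys v rest)
      miss : ∀ k → k ≢ j → after v (lookup (rhs p) k) ≡ nothing
      miss k k≢j = after-∉ (lookup (rhs p) k)
        (λ v∈ₖ → Unique-concatMap⇒Disjoint-lookup varsOf (rhs p) (linear p) k≢j (v∈ₖ , v∈ⱼ))

  module TupleComposition (p : Production) (args : (i : Fin (n p)) → Vec (List T) (ar (body p i)))
                          (τ : (i : Fin (n p)) → Cowordism ∅ (body p i))
                          (τ≐ : ∀ i → τ i ≐ ⟦ body p i ⟨ args i ⟩⟧) where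
    open ProdCow p
    open ProductionSteps p
    open Comp ⟦ p ⟧ₚ τ
    open CompositionSteps ⟦ p ⟧ₚ τ
    open ≡-Reasoning

    τstep-args : ∀ d → τstep d ≡ (d , lookup (args (proj₁ d)) (proj₂ d))
    τstep-args (i , j) =
      trans (τstep-straight (edge-≡ (τ≐ i) (inj₂ j))) (cong ((i , j) ,_) (label-≡ (τ≐ i) (inj₂ j)))

    pathFrom-reads : ∀ f j zs xs s → lookup (rhs p) j ≡ zs ++ xs → length (varsOf xs) ≤ f
                   → out s ≡ next xs j → pathFrom f s ≡ just (j , instantiate args xs)
    pathFrom-reads f j zs xs s split bound out≡ with firstVar? xs
    ... | noVar as = begin
        pathFrom f s                              ≡⟨ pathFrom-exit f s (cong proj₁ out≡′) ⟩
        just (j , proj₂ (out s))                  ≡⟨ cong (λ w → just (j , w)) (cong proj₂ out≡′) ⟩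
        just (j , as)                             ≡⟨ cong (λ w → just (j , w)) (sym (instantiate-terminals args as)) ⟩
        just (j , instantiate args (map inj₁ as)) ∎
      where
      out≡′ : out s ≡ (inj₂ j , as)
      out≡′ = trans out≡ (next-noVar as j)
    ... | firstVar as v rest =
      through f (subst (λ vs → length vs ≤ f) (varsOf-terminals++ as (inj₂ v ∷ rest)) bound)
      where
      out≡′ : out s ≡ (inj₁ v , as)
      out≡′ = trans out≡ (next-firstVar as v rest j)
      tᵥ : List T
      tᵥ = lookup (args (proj₁ v)) (proj₂ v)
      through : ∀ f → suc (length (varsOf rest)) ≤ f
              → pathFrom f s ≡ just (j , instantiate args (map inj₁ as ++ inj₂ v ∷ rest))
      through (suc f) (s≤s bound′) = begin
          pathFrom (suc f) s
        ≡⟨ pathFrom-through f s (cong proj₁ out≡′) (τstep-args v)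
             (pathFrom-reads f j _ rest (inj₁ v) (trans split (++-∷-reassoc zs (map inj₁ as) (inj₂ v) rest)) bound′
               (out-var (trans split (sym (++-assoc zs (map inj₁ as) _))))) ⟩
          just (j , proj₂ (out s) ++ tᵥ ++ instantiate args rest)
        ≡⟨ cong (λ w → just (j , w ++ tᵥ ++ instantiate args rest)) (cong proj₂ out≡′) ⟩
          just (j , as ++ tᵥ ++ instantiate args rest)
        ≡⟨ cong (λ w → just (j , w)) (sym (instantiate-terminals++ args as (inj₂ v ∷ rest))) ⟩
          just (j , instantiate args (map inj₁ as ++ inj₂ v ∷ rest)) ∎

    loopFrom-avoids : ∀ f j zs xs start cur → lookup (rhs p) j ≡ zs ++ xs → start ∉ varsOf xs
                    → out (inj₁ cur) ≡ next xs j → loopFrom f start cur ≡ nothing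
    loopFrom-avoids zero    j zs xs start cur split start∉ out≡ = refl
    loopFrom-avoids (suc f) j zs xs start cur split start∉ out≡ with firstVar? xs
    ... | noVar as = loopFrom-exit (suc f) start cur (cong proj₁ (trans out≡ (next-noVar as j)))
    ... | firstVar as v rest =
      loopFrom-through f start cur (cong proj₁ (trans out≡ (next-firstVar as v rest j))) (τstep-args v)
        (λ v≡start → start∉′ (here (sym v≡start)))
        (loopFrom-avoids f j _ rest start v (trans split (++-∷-reassoc zs (map inj₁ as) (inj₂ v) rest))
          (λ start∈ → start∉′ (there start∈)) (out-var (trans split (sym (++-assoc zs (map inj₁ as) _)))))
      where
      start∉′ : start ∉ v ∷ varsOf rest
      start∉′ = subst (start ∉_) (varsOf-terminals++ as (inj₂ v ∷ rest)) start∉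

    pathFrom-component : ∀ j → pathFrom fuel (inj₂ j) ≡ just (j , instantiate args (lookup (rhs p) j))
    pathFrom-component j =
      pathFrom-reads fuel j [] _ (inj₂ j) refl (≤-trans (varsOf-rhs-bounded j) (n≤1+n _)) refl

    newLoop-empty : ∀ d → newLoop d ≡ []
    newLoop-empty d with occurrence d
    ... | j , ys , rest , split =
      newLoop-none d (loopFrom-avoids fuel j (ys ++ [ inj₂ d ]) rest d d
        (trans split (sym (++-assoc ys [ inj₂ d ] rest))) (proj₂ (occurrence-linear split)) (out-var split))

    ∘⊗-tuples : ⟦ p ⟧ₚ ∘⊗ τ ≐ ⟦ head p ⟨ mapᵥ (instantiate args) (rhs p) ⟩⟧
    edge-≡  ∘⊗-tuples (inj₁ (() , _))
    edge-≡  ∘⊗-tuples (inj₂ j) rewrite pathFrom-component j = refl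
    label-≡ ∘⊗-tuples (inj₁ (() , _))
    label-≡ ∘⊗-tuples (inj₂ j) rewrite pathFrom-component j = sym (lookup-map j (instantiate args) (rhs p))
    loops-≡ ∘⊗-tuples =
      cong₂ _++_ (concatMap-[] (λ i → loops (τ i)) (allFin (n p)) (λ i → loops-≡ (τ≐ i)))
                 (concatMap-[] newLoop (allDPt (body p)) newLoop-empty)

module Derivations (G : MCFG) where
  open MCFG G
  open Base N T ar
  open Cowordisms N T ar

  completeness : ∀ {C t} → ⊢G G C t → ∃ λ ρ → ⊢G' G C ρ × ρ ≐ ⟦ C ⟨ t ⟩⟧
  completeness (rule p p∈P args ⊢args) =
    _ , gen p p∈P τ (λ i → proj₁ (proj₂ (ih i))) ,
    TupleComposition.∘⊗-tuples p args τ (λ i → proj₂ (proj₂ (ih i)))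
    where
    ih : ∀ i → ∃ λ ρ → ⊢G' G (body p i) ρ × ρ ≐ ⟦ body p i ⟨ args i ⟩⟧
    ih i = completeness (⊢args i)
    τ : ∀ i → Cowordism ∅ (body p i)
    τ i = proj₁ (ih i)

  soundness : ∀ {C ρ} → ⊢G' G C ρ → ∃ λ t → ⊢G G C t × ρ ≐ ⟦ C ⟨ t ⟩⟧
  soundness (gen p p∈P τ ⊢τ) =
    _ , rule p p∈P args (λ i → proj₁ (proj₂ (ih i))) ,
    TupleComposition.∘⊗-tuples p args τ (λ i → proj₂ (proj₂ (ih i)))
    where
    ih : ∀ i → ∃ λ t → ⊢G G (body p i) t × τ i ≐ ⟦ body p i ⟨ t ⟩⟧
    ih i = soundness (⊢τ i)
    args : ∀ i → Vec (List T) (ar (body p i))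
    args i = proj₁ (ih i)

  derivable⇒derivable′ : ∀ {C s} → ⊢G G C s → Derivable' G C ⟦ C ⟨ s ⟩⟧
  derivable⇒derivable′ ⊢s with completeness ⊢s
  ... | ρ , ⊢ρ , ρ≐ = ρ , ⊢ρ , ≐⇒≈ ρ≐

  derivable′⇒derivable : ∀ {C s} → Derivable' G C ⟦ C ⟨ s ⟩⟧ → ⊢G G C s
  derivable′⇒derivable {C} {s} (ρ , ⊢ρ , (_ , ρ-labels , _)) with soundness ⊢ρ
  ... | t , ⊢t , ρ≐ = subst (⊢G G C) t≡s ⊢t
    where
    t≡s : t ≡ s
    t≡s = Pointwise-≡⇒≡ (ext (λ j → trans (sym (label-≡ ρ≐ (inj₂ j))) (ρ-labels (inj₂ j))))

  LG⇒LG′ : ∀ {w} → LG G w → LG' G w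
  LG⇒LG′ {w} ⊢w with completeness ⊢w
  ... | ρ , ⊢ρ , ρ≐ =
    ρ , ⊢ρ , loops-≡ ρ≐ , trans (label-≡ ρ≐ (inj₂ (sPt G))) (lookup-singleton-subst S-unary w)

  LG′⇒LG : ∀ {w} → LG' G w → LG G w
  LG′⇒LG {w} (ρ , ⊢ρ , _ , ρ-label) with soundness ⊢ρ
  ... | t , ⊢t , ρ≐ =
    subst (⊢G G S) (≡-singleton-subst S-unary w t (trans (sym (label-≡ ρ≐ (inj₂ (sPt G)))) ρ-label)) ⊢t

mainTheorem19 : (G : MCFG)
    → ((C : MCFG.N G) (s : Vec (List (MCFG.T G)) (MCFG.ar G C))
         → ⊢G G C s ⇔ Derivable' G C (Base.⟦_⟨_⟩⟧ (MCFG.N G) (MCFG.T G) (MCFG.ar G) C s))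
      × ((w : List (MCFG.T G)) → LG G w ⇔ LG' G w)
mainTheorem19 G =
  (λ C s → mk⇔ derivable⇒derivable′ derivable′⇒derivable) , (λ w → mk⇔ LG⇒LG′ LG′⇒LG)
  where open Derivations G
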